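{- Let $\tau=\{P_1,\dots,P_k\}$ be a signature in which every $P_i$ is a unary relation symbol. Then every class of finite structures of signature $\tau$ is decided by a non-adaptive left $2^k$-query algorithm over $\mathbb{N}$.
   Context: Structures are finite relational structures with non-empty domain; classes of structures are closed under isomorphism. $\hom(F,D)$ is the number of homomorphisms from $F$ to $D$. A non-adaptive left $m$-query algorithm over $\mathbb{N}$ is a pair $((F_1,\dots,F_m),X)$ with $F_i$ finite structures of signature $\tau$ and $X\subseteq\mathbb{N}^m$; it decides the class $\{D:(\hom(F_1,D),\dots,\hom(F_m,D))\in X\}$. -}

module Defs where

open import Data.Nat using (ℕ; zero; suc)
open import Data.Bool using (Bool; true; false; _∧_; _∨_; not)
open import Data.Fin using (Fin)
open import Data.Vec using (Vec; []; _∷_; lookup)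
open import Data.List using (List; []; _∷_; map; concatMap; length; filter; allFin)
open import Data.Bool.ListAction using (and)
open import Data.Product using (_×_)
open import Data.Bool.Properties using (T?)
open import Relation.Binary.PropositionalEquality using (_≡_)

record Str (k : ℕ) : Set where
  constructor mkStr
  field
    size : ℕ
    rel  : Fin k → Fin (suc size) → Bool

Dom : ∀ {k} → Str k → Set
Dom A = Fin (suc (Str.size A))

-- A homomorphism A → B is a map of domains preserving every relation P_i;
-- maps Fin a → Fin b are enumerated as vectors, checked by isHomB.

allVecs : (a b : ℕ) → List (Vec (Fin b) a)
allVecs zero    b = [] ∷ []
allVecs (suc a) b = concatMap (λ y → map (y ∷_) (allVecs a b)) (allFin b)

isHomB : ∀ {k} (A B : Str k) → Vec (Dom B) (suc (Str.size A)) → Bool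
isHomB {k} A B v =
  and (concatMap (λ i → map (λ x → not (Str.rel A i x) ∨ Str.rel B i (lookup v x))
                            (allFin (suc (Str.size A))))
                 (allFin k))

hom : ∀ {k} → Str k → Str k → ℕ
hom A B = length (filter (λ v → T? (isHomB A B v))
                         (allVecs (suc (Str.size A)) (suc (Str.size B))))

record Iso {k : ℕ} (A B : Str k) : Set where
  field
    to      : Dom A → Dom B
    from    : Dom B → Dom A
    from∘to : ∀ x → from (to x) ≡ x
    to∘from : ∀ y → to (from y) ≡ y
    rel-iso : ∀ (i : Fin k) (x : Dom A) → Str.rel A i x ≡ Str.rel B i (to x)

IsoClosed : ∀ {k} → (Str k → Set) → Set
IsoClosed {k} C = ∀ (A B : Str k) → Iso A B → C A → C B

-- The class decided by the non-adaptive left m-query algorithm ((F₁,…,F_m), X):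
-- D belongs to it iff (hom(F₁,D),…,hom(F_m,D)) ∈ X.
homVec : ∀ {k m} → Vec (Str k) m → Str k → Vec ℕ m
homVec []       D = []
homVec (F ∷ Fs) D = hom F D ∷ homVec Fs D

Decides : ∀ {k m} → Vec (Str k) m → (Vec ℕ m → Set) → (Str k → Set) → Set
Decides {k} Fs X C = ∀ (D : Str k) → (C D → X (homVec Fs D)) × (X (homVec Fs D) → C D)

{-# OPTIONS --safe #-}
-- Call the set of relations P_i an element satisfies its type. Homomorphisms from the
-- one-point structure of type S into D are exactly the elements of D whose type contains
-- S, so the 2^k one-point queries count, for every S ⊆ τ, the elements whose type is a
-- superset of S. By Möbius inversion over the Boolean lattice these numbers determine how
-- many elements of D have each exact type, and two structures with the same number of
-- elements of every type are isomorphic. So the hom vector determines D up to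
-- isomorphism, and X can be taken to be the set of hom vectors of the members of the class.

module Submission where

open import Defs
open import Data.Nat using (ℕ; zero; suc; _+_; _^_)
open import Data.Nat.Properties using (+-cancelˡ-≡; +-identityʳ; +-suc; suc-injective; 0≢1+n)
open import Data.Bool using (Bool; true; false; _∧_; _∨_; not; T)
import Data.Bool as Bool
open import Data.Bool.ListAction using (and)
open import Data.Fin using (Fin; zero; suc; punchIn)
open import Data.Fin.Permutation using (_⟨$⟩ʳ_; _⟨$⟩ˡ_; inverseˡ; inverseʳ; insert; insert-punchIn)
import Data.Fin.Permutation as Permutation
open import Data.List using (List; []; _∷_; [_]; map; tabulate; concatMap; allFin; length; filterᵇ)
open import Data.List.Properties using (concatMap-map; concatMap-pure; map-tabulate)
import Data.List.Relation.Binary.Permutation.Propositional as List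
open import Data.List.Relation.Binary.Permutation.Propositional.Properties using (filter-↭; ↭-length)
open import Data.Vec using (Vec; []; _∷_; lookup; head; tail)
import Data.Vec as Vec
open import Data.Vec.Properties using (≡-dec; lookup∘tabulate; ∷-injectiveˡ; ∷-injectiveʳ)
open import Data.Vec.Functional using (Vector)
open import Data.Vec.Functional.Relation.Binary.Permutation using (_↭_)
open import Data.Vec.Membership.Propositional using (_∈_)
open import Data.Vec.Membership.Propositional.Properties using (∈-map⁺; ∈-++⁺ˡ; ∈-++⁺ʳ)
open import Data.Vec.Relation.Unary.Any using (here; there)
open import Data.Product using (Σ; ∃; _×_; _,_; proj₁; proj₂)
open import Data.Unit using (tt)
open import Function using (_∘_)
open import Relation.Binary.Definitions using (DecidableEquality)
open import Relation.Binary.PropositionalEquality using (_≡_; refl; sym; trans; cong; subst; module ≡-Reasoning)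
open import Relation.Nullary using (does; yes; contradiction)
open import Relation.Nullary.Decidable using (T?; dec-true)

countᵇ : ∀ {A : Set} → (A → Bool) → List A → ℕ
countᵇ p xs = length (filterᵇ p xs)

module _ {A : Set} (p : A → Bool) where

  countᵇ-cong : ∀ {q : A → Bool} → (∀ x → p x ≡ q x) → ∀ xs → countᵇ p xs ≡ countᵇ q xs
  countᵇ-cong p≗q [] = refl
  countᵇ-cong {q} p≗q (x ∷ xs) with p x | q x | p≗q x
  ... | true  | .true  | refl = cong suc (countᵇ-cong p≗q xs)
  ... | false | .false | refl = countᵇ-cong p≗q xs

  countᵇ-vanishing : (∀ x → p x ≡ false) → ∀ xs → countᵇ p xs ≡ 0
  countᵇ-vanishing p≡false [] = refl
  countᵇ-vanishing p≡false (x ∷ xs) rewrite p≡false x = countᵇ-vanishing p≡false xs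

  countᵇ-map : ∀ {B : Set} (f : B → A) xs → countᵇ p (map f xs) ≡ countᵇ (p ∘ f) xs
  countᵇ-map f [] = refl
  countᵇ-map f (x ∷ xs) with p (f x)
  ... | true  = cong suc (countᵇ-map f xs)
  ... | false = countᵇ-map f xs

  countᵇ-↭ : ∀ {xs ys} → xs List.↭ ys → countᵇ p xs ≡ countᵇ p ys
  countᵇ-↭ xs↭ys = ↭-length (filter-↭ (T? ∘ p) xs↭ys)

  countᵇ-∷-cancel : ∀ x {xs ys} → countᵇ p (x ∷ xs) ≡ countᵇ p (x ∷ ys) → countᵇ p xs ≡ countᵇ p ys
  countᵇ-∷-cancel x eq with p x
  ... | true  = suc-injective eq
  ... | false = eq

  countᵇ-tabulate-witness : ∀ {n c} (g : Fin n → A) → countᵇ p (tabulate g) ≡ suc c → ∃ λ j → T (p (g j))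
  countᵇ-tabulate-witness {zero} g ()
  countᵇ-tabulate-witness {suc n} g count≡1+c with p (g zero) in pg₀
  ... | true  = zero , subst T (sym pg₀) tt
  ... | false with countᵇ-tabulate-witness (g ∘ suc) count≡1+c
  ...   | j , pgj = suc j , pgj

tabulate-↭-punchIn : ∀ {A : Set} {n} (g : Fin (suc n) → A) j → tabulate g List.↭ g j ∷ tabulate (g ∘ punchIn j)
tabulate-↭-punchIn g zero = List.↭-refl
tabulate-↭-punchIn {n = suc n} g (suc j) =
  List.↭-trans (List.prep (g zero) (tabulate-↭-punchIn (g ∘ suc) j)) (List.swap (g zero) (g (suc j)) List.↭-refl)

module _ {A : Set} (_≟_ : DecidableEquality A) where

  private
    _≡ᵇ_ : A → A → Bool
    x ≡ᵇ y = does (x ≟ y)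

    ≡ᵇ⇒≡ : ∀ {x y} → T (x ≡ᵇ y) → x ≡ y
    ≡ᵇ⇒≡ {x} {y} x≡ᵇy with x ≟ y
    ... | yes x≡y = x≡y

    countᵇ-self : ∀ x xs → countᵇ (x ≡ᵇ_) (x ∷ xs) ≡ suc (countᵇ (x ≡ᵇ_) xs)
    countᵇ-self x xs rewrite dec-true (x ≟ x) refl = refl

  counts⇒↭ : ∀ {m n} (f : Vector A m) (g : Vector A n) →
    (∀ t → countᵇ (t ≡ᵇ_) (tabulate f) ≡ countᵇ (t ≡ᵇ_) (tabulate g)) → g ↭ f
  counts⇒↭ {zero}  {zero}  f g same = Permutation.id , λ ()
  counts⇒↭ {zero}  {suc n} f g same = contradiction (trans (same (g zero)) (countᵇ-self (g zero) _)) 0≢1+n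
  counts⇒↭ {suc m} {zero}  f g same = contradiction (trans (sym (countᵇ-self (f zero) _)) (same (f zero))) (0≢1+n ∘ sym)
  counts⇒↭ {suc m} {suc n} f g same = insert zero j ρ , g∘insert≗f
    where
    f₀-occurs : ∃ λ j → T (f zero ≡ᵇ g j)
    f₀-occurs = countᵇ-tabulate-witness (f zero ≡ᵇ_) g (trans (sym (same (f zero))) (countᵇ-self (f zero) _))
    j : Fin (suc n)
    j = proj₁ f₀-occurs
    gj≡f₀ : g j ≡ f zero
    gj≡f₀ = sym (≡ᵇ⇒≡ (proj₂ f₀-occurs))

    same-rest : ∀ t → countᵇ (t ≡ᵇ_) (tabulate (f ∘ suc)) ≡ countᵇ (t ≡ᵇ_) (tabulate (g ∘ punchIn j))
    same-rest t = countᵇ-∷-cancel (t ≡ᵇ_) (f zero) (begin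
      countᵇ (t ≡ᵇ_) (tabulate f)                             ≡⟨ same t ⟩
      countᵇ (t ≡ᵇ_) (tabulate g)                             ≡⟨ countᵇ-↭ (t ≡ᵇ_) (tabulate-↭-punchIn g j) ⟩
      countᵇ (t ≡ᵇ_) (g j ∷ tabulate (g ∘ punchIn j))         ≡⟨ cong (λ x → countᵇ (t ≡ᵇ_) (x ∷ tabulate (g ∘ punchIn j))) gj≡f₀ ⟩
      countᵇ (t ≡ᵇ_) (f zero ∷ tabulate (g ∘ punchIn j))      ∎)
      where open ≡-Reasoning

    rest↭ : (g ∘ punchIn j) ↭ (f ∘ suc)
    rest↭ = counts⇒↭ (f ∘ suc) (g ∘ punchIn j) same-rest

    ρ : Permutation.Permutation m n
    ρ = proj₁ rest↭

    g∘insert≗f : ∀ i → g (insert zero j ρ ⟨$⟩ʳ i) ≡ f i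
    g∘insert≗f zero    = gj≡f₀
    g∘insert≗f (suc i) = trans (cong g (insert-punchIn zero j ρ i)) (proj₂ rest↭ i)

_⊆ᵇ_ : ∀ {k} → Vec Bool k → Vec Bool k → Bool
[]      ⊆ᵇ []      = true
(s ∷ S) ⊆ᵇ (t ∷ T) = (not s ∨ t) ∧ S ⊆ᵇ T

_≡ᵇ_ : ∀ {k} → Vec Bool k → Vec Bool k → Bool
t ≡ᵇ u = does (≡-dec Bool._≟_ t u)

fibre : ∀ {k} → Bool → List (Vec Bool (suc k)) → List (Vec Bool k)
fibre b xs = map tail (filterᵇ (λ u → does (b Bool.≟ head u)) xs)

countᵇ-by-head : ∀ {k} (p : Vec Bool (suc k) → Bool) xs →
  countᵇ p xs ≡ countᵇ (p ∘ (true ∷_)) (fibre true xs) + countᵇ (p ∘ (false ∷_)) (fibre false xs)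
countᵇ-by-head p [] = refl
countᵇ-by-head p ((true ∷ u) ∷ xs) with p (true ∷ u)
... | true  = cong suc (countᵇ-by-head p xs)
... | false = countᵇ-by-head p xs
countᵇ-by-head p ((false ∷ u) ∷ xs) with p (false ∷ u)
... | true  = trans (cong suc (countᵇ-by-head p xs)) (sym (+-suc _ _))
... | false = countᵇ-by-head p xs

countᵇ-fibre : ∀ {k} b (p : Vec Bool (suc k) → Bool) → (∀ u → p (not b ∷ u) ≡ false) →
  ∀ xs → countᵇ p xs ≡ countᵇ (p ∘ (b ∷_)) (fibre b xs)
countᵇ-fibre {k} true p vanish xs = begin
  countᵇ p xs
    ≡⟨ countᵇ-by-head p xs ⟩
  countᵇ p₁ (fibre true xs) + countᵇ p₀ (fibre false xs)
    ≡⟨ cong (countᵇ p₁ (fibre true xs) +_) (countᵇ-vanishing p₀ vanish (fibre false xs)) ⟩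
  countᵇ p₁ (fibre true xs) + 0
    ≡⟨ +-identityʳ _ ⟩
  countᵇ p₁ (fibre true xs) ∎
  where
  open ≡-Reasoning
  p₁ p₀ : Vec Bool k → Bool
  p₁ = p ∘ (true ∷_)
  p₀ = p ∘ (false ∷_)
countᵇ-fibre false p vanish xs =
  trans (countᵇ-by-head p xs)
        (cong (_+ countᵇ (p ∘ (false ∷_)) (fibre false xs)) (countᵇ-vanishing _ vanish (fibre true xs)))

-- Möbius inversion by induction on k: on the fibre over true the superset counts of S
-- are those of true ∷ S, on the fibre over false those of false ∷ S minus those of true ∷ S.
superset-counts⇒counts : ∀ {k} (xs ys : List (Vec Bool k)) →
  (∀ S → countᵇ (S ⊆ᵇ_) xs ≡ countᵇ (S ⊆ᵇ_) ys) → ∀ t → countᵇ (t ≡ᵇ_) xs ≡ countᵇ (t ≡ᵇ_) ys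
superset-counts⇒counts {zero} xs ys same [] = begin
  countᵇ ([] ≡ᵇ_) xs  ≡⟨ countᵇ-cong _ ≡ᵇ≗⊆ᵇ xs ⟩
  countᵇ ([] ⊆ᵇ_) xs  ≡⟨ same [] ⟩
  countᵇ ([] ⊆ᵇ_) ys  ≡⟨ countᵇ-cong _ ≡ᵇ≗⊆ᵇ ys ⟨
  countᵇ ([] ≡ᵇ_) ys  ∎
  where
  open ≡-Reasoning
  ≡ᵇ≗⊆ᵇ : ∀ u → ([] ≡ᵇ u) ≡ ([] ⊆ᵇ u)
  ≡ᵇ≗⊆ᵇ [] = refl
superset-counts⇒counts {suc k} xs ys same (b ∷ t) = begin
  countᵇ ((b ∷ t) ≡ᵇ_) xs    ≡⟨ countᵇ-≡ᵇ-fibre b xs ⟩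
  countᵇ (t ≡ᵇ_) (fibre b xs) ≡⟨ superset-counts⇒counts (fibre b xs) (fibre b ys) (same-on-fibre b) t ⟩
  countᵇ (t ≡ᵇ_) (fibre b ys) ≡⟨ countᵇ-≡ᵇ-fibre b ys ⟨
  countᵇ ((b ∷ t) ≡ᵇ_) ys    ∎
  where
  open ≡-Reasoning
  countᵇ-≡ᵇ-fibre : ∀ b zs → countᵇ ((b ∷ t) ≡ᵇ_) zs ≡ countᵇ (t ≡ᵇ_) (fibre b zs)
  countᵇ-≡ᵇ-fibre true  = countᵇ-fibre true  _ (λ _ → refl)
  countᵇ-≡ᵇ-fibre false = countᵇ-fibre false _ (λ _ → refl)

  same-on-fibre : ∀ b S → countᵇ (S ⊆ᵇ_) (fibre b xs) ≡ countᵇ (S ⊆ᵇ_) (fibre b ys)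
  same-on-fibre true S = begin
    countᵇ (S ⊆ᵇ_) (fibre true xs)  ≡⟨ countᵇ-fibre true _ (λ _ → refl) xs ⟨
    countᵇ ((true ∷ S) ⊆ᵇ_) xs      ≡⟨ same (true ∷ S) ⟩
    countᵇ ((true ∷ S) ⊆ᵇ_) ys      ≡⟨ countᵇ-fibre true _ (λ _ → refl) ys ⟩
    countᵇ (S ⊆ᵇ_) (fibre true ys)  ∎
  same-on-fibre false S = +-cancelˡ-≡ (countᵇ (S ⊆ᵇ_) (fibre true xs)) _ _ (begin
    countᵇ (S ⊆ᵇ_) (fibre true xs) + countᵇ (S ⊆ᵇ_) (fibre false xs)  ≡⟨ countᵇ-by-head _ xs ⟨
    countᵇ ((false ∷ S) ⊆ᵇ_) xs                                        ≡⟨ same (false ∷ S) ⟩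
    countᵇ ((false ∷ S) ⊆ᵇ_) ys                                        ≡⟨ countᵇ-by-head _ ys ⟩
    countᵇ (S ⊆ᵇ_) (fibre true ys) + countᵇ (S ⊆ᵇ_) (fibre false ys)  ≡⟨ cong (_+ _) (same-on-fibre true S) ⟨
    countᵇ (S ⊆ᵇ_) (fibre true xs) + countᵇ (S ⊆ᵇ_) (fibre false ys)  ∎)

typeOf : ∀ {k} (D : Str k) → Dom D → Vec Bool k
typeOf D y = Vec.tabulate (λ i → Str.rel D i y)

types : ∀ {k} → Str k → List (Vec Bool k)
types D = tabulate (typeOf D)

point : ∀ {k} → Vec Bool k → Str k
point S = mkStr 0 (λ i _ → lookup S i)

concatMap-singleton : ∀ {A B : Set} (f : A → B) xs → concatMap (λ x → [ f x ]) xs ≡ map f xs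
concatMap-singleton f xs = trans (sym (concatMap-map [_] f xs)) (concatMap-pure (map f xs))

⊆ᵇ-tabulate : ∀ {k} (S : Vec Bool k) (r : Fin k → Bool) →
  S ⊆ᵇ Vec.tabulate r ≡ and (tabulate (λ i → not (lookup S i) ∨ r i))
⊆ᵇ-tabulate []      r = refl
⊆ᵇ-tabulate (s ∷ S) r = cong ((not s ∨ r zero) ∧_) (⊆ᵇ-tabulate S (r ∘ suc))

isHomB-point : ∀ {k} (S : Vec Bool k) (D : Str k) y → isHomB (point S) D (y ∷ []) ≡ S ⊆ᵇ typeOf D y
isHomB-point {k} S D y = begin
  and (concatMap (λ i → [ g i ]) (allFin k))  ≡⟨ cong and (concatMap-singleton g (allFin k)) ⟩
  and (map g (allFin k))                      ≡⟨ cong and (map-tabulate (λ i → i) g) ⟩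
  and (tabulate g)                            ≡⟨ ⊆ᵇ-tabulate S (λ i → Str.rel D i y) ⟨
  S ⊆ᵇ typeOf D y                             ∎
  where
  open ≡-Reasoning
  g : Fin k → Bool
  g i = not (lookup S i) ∨ Str.rel D i y

hom-point : ∀ {k} (S : Vec Bool k) (D : Str k) → hom (point S) D ≡ countᵇ (S ⊆ᵇ_) (types D)
hom-point S D = begin
  countᵇ (isHomB (point S) D) (concatMap (λ y → [ y ∷ [] ]) (allFin N))
    ≡⟨ cong (countᵇ (isHomB (point S) D)) (concatMap-singleton (_∷ []) (allFin N)) ⟩
  countᵇ (isHomB (point S) D) (map (_∷ []) (allFin N))  ≡⟨ countᵇ-map (isHomB (point S) D) (_∷ []) (allFin N) ⟩
  countᵇ (λ y → isHomB (point S) D (y ∷ [])) (allFin N)  ≡⟨ countᵇ-cong _ (isHomB-point S D) (allFin N) ⟩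
  countᵇ (λ y → S ⊆ᵇ typeOf D y) (allFin N)              ≡⟨ countᵇ-map (S ⊆ᵇ_) (typeOf D) (allFin N) ⟨
  countᵇ (S ⊆ᵇ_) (map (typeOf D) (allFin N))             ≡⟨ cong (countᵇ (S ⊆ᵇ_)) (map-tabulate (λ y → y) (typeOf D)) ⟩
  countᵇ (S ⊆ᵇ_) (types D)                               ∎
  where
  open ≡-Reasoning
  N : ℕ
  N = suc (Str.size D)

↭⇒Iso : ∀ {k} (D D' : Str k) → typeOf D' ↭ typeOf D → Iso D D'
↭⇒Iso D D' (ρ , typeOf-ρ) = record
  { to      = ρ ⟨$⟩ʳ_
  ; from    = ρ ⟨$⟩ˡ_
  ; from∘to = λ _ → inverseˡ ρ
  ; to∘from = λ _ → inverseʳ ρ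
  ; rel-iso = rel-iso
  }
  where
  rel-iso : ∀ i x → Str.rel D i x ≡ Str.rel D' i (ρ ⟨$⟩ʳ x)
  rel-iso i x = begin
    Str.rel D i x                  ≡⟨ lookup∘tabulate _ i ⟨
    lookup (typeOf D x) i          ≡⟨ cong (λ t → lookup t i) (typeOf-ρ x) ⟨
    lookup (typeOf D' (ρ ⟨$⟩ʳ x)) i ≡⟨ lookup∘tabulate _ i ⟩
    Str.rel D' i (ρ ⟨$⟩ʳ x)         ∎
    where open ≡-Reasoning

hom-points⇒Iso : ∀ {k} (D D' : Str k) → (∀ S → hom (point S) D ≡ hom (point S) D') → Iso D D'
hom-points⇒Iso D D' same = ↭⇒Iso D D'
  (counts⇒↭ (≡-dec Bool._≟_) (typeOf D) (typeOf D')
    (superset-counts⇒counts (types D) (types D') (λ S →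
      trans (sym (hom-point S D)) (trans (same S) (hom-point S D')))))

subsets : ∀ k → Vec (Vec Bool k) (2 ^ k)
subsets zero    = [] ∷ []
subsets (suc k) = Vec.map (true ∷_) (subsets k) Vec.++ (Vec.map (false ∷_) (subsets k) Vec.++ [])

∈-subsets : ∀ {k} (S : Vec Bool k) → S ∈ subsets k
∈-subsets []          = here refl
∈-subsets (true  ∷ S) = ∈-++⁺ˡ (∈-map⁺ (true ∷_) (∈-subsets S))
∈-subsets (false ∷ S) = ∈-++⁺ʳ (Vec.map (true ∷_) (subsets _)) (∈-++⁺ˡ (∈-map⁺ (false ∷_) (∈-subsets S)))

homVec-≡⇒hom-≡ : ∀ {k m} {Fs : Vec (Str k) m} {F D D'} → F ∈ Fs → homVec Fs D ≡ homVec Fs D' → hom F D ≡ hom F D'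
homVec-≡⇒hom-≡ (here refl)  eq = ∷-injectiveˡ eq
homVec-≡⇒hom-≡ (there F∈Fs) eq = homVec-≡⇒hom-≡ F∈Fs (∷-injectiveʳ eq)

homImage : ∀ {k m} → Vec (Str k) m → (Str k → Set) → Vec ℕ m → Set
homImage Fs C v = ∃ λ D → C D × homVec Fs D ≡ v

Decides-homImage : ∀ {k m} (Fs : Vec (Str k) m) (C : Str k → Set) → IsoClosed C →
  (∀ D D' → homVec Fs D ≡ homVec Fs D' → Iso D D') → Decides Fs (homImage Fs C) C
Decides-homImage Fs C closed separating D =
  (λ C-D → D , C-D , refl) , λ (D' , C-D' , eq) → closed D' D (separating D' D eq) C-D'

theorem38 : (k : ℕ) (C : Str k → Set) → IsoClosed C →
    Σ (Vec (Str k) (2 ^ k)) λ Fs → Σ (Vec ℕ (2 ^ k) → Set) λ X → Decides Fs X C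
theorem38 k C closed = queries , homImage queries C , Decides-homImage queries C closed separating
  where
  queries : Vec (Str k) (2 ^ k)
  queries = Vec.map point (subsets k)
  separating : ∀ D D' → homVec queries D ≡ homVec queries D' → Iso D D'
  separating D D' eq = hom-points⇒Iso D D' λ S → homVec-≡⇒hom-≡ (∈-map⁺ point (∈-subsets S)) eq
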